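{- Let $G=(V,E)$ be a simple undirected graph with $V=\{0,1,\ldots,n-1\}$, and let $p:\mathrm{GF}(2)^n\to\mathrm{GF}(2)$ be a Boolean function of degree at most $2$ whose quadratic part is $\sum_{ab\in E} x_ax_b$. Let $ij\in E$, and write (uniquely) $p=x_ix_j+x_i\mathcal N_i+x_j\mathcal N_j+R$, where $\mathcal N_i,\mathcal N_j,R$ are Boolean functions not depending on $x_i$ or $x_j$ (so, up to constant terms, $\mathcal N_i=\sum_{k\in\mathcal N(i)\setminus\{j\}}x_k$ and similarly for $\mathcal N_j$). Define $$p_{iji}=x_ix_j+x_i\mathcal N_j+x_j\mathcal N_i+\mathcal N_i\mathcal N_j+R=p+(x_i+x_j)(\mathcal N_i+\mathcal N_j)+\mathcal N_i\mathcal N_j .$$ Then the quadratic part of $p_{iji}$ (the sum of the degree-$2$ monomials of its algebraic normal form) equals $\sum_{ab\in E'}x_ax_b$, where $G'=(V,E')$ is the graph obtained from $G$ by pivoting on the edge $ij$; that is, $p_{iji}$ is the Boolean function associated with $G'$ up to terms of degree at most $1$.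
   Context: $\mathcal N(a)$ denotes the set of neighbours of vertex $a$ in $G$. Pivoting on an edge $ij$ of $G$ is defined as follows: partition $V\setminus\{i,j\}$ into the four sets $\mathcal N(i)\setminus\mathcal N(j)$, $\mathcal N(j)\setminus\mathcal N(i)$, $\mathcal N(i)\cap\mathcal N(j)$, and the set of vertices adjacent to neither $i$ nor $j$. For every pair $\{x,y\}$ with $x$ and $y$ lying in two different ones among the first three of these sets, toggle the pair (delete the edge $xy$ if present, add it if absent). Finally swap the labels of the vertices $i$ and $j$ (i.e. apply the transposition $(i\,j)$ to the vertex set). Arithmetic of Boolean functions is in $\mathrm{GF}(2)$, using algebraic normal form. -}

module Defs where

open import Data.Nat using (ℕ; zero; suc; _≤_)
open import Data.Bool using (Bool; true; false; _xor_; _∧_; _∨_; not; if_then_else_)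
open import Data.Fin using (Fin; _≟_)
open import Data.Fin.Subset using (Subset; ⁅_⁆; _∪_; ∣_∣)
open import Data.Vec using (Vec; []; _∷_; lookup; _[_]≔_)
open import Data.List using (List; []; _∷_; map; _++_; foldr)
open import Relation.Binary.PropositionalEquality using (_≡_; _≢_)
open import Relation.Nullary using (does)

record Graph (n : ℕ) : Set where
  field
    adj    : Fin n → Fin n → Bool
    sym    : ∀ a b → adj a b ≡ adj b a
    irrefl : ∀ a → adj a a ≡ false
open Graph public

-- Boolean functions GF(2)^n → GF(2); GF(2) = Bool, + = xor, · = ∧

BF : ℕ → Set
BF n = Vec Bool n → Bool

var : ∀ {n} → Fin n → BF n
var i v = lookup v i

infixl 6 _⊕_
infixl 7 _⊙_
_⊕_ : ∀ {n} → BF n → BF n → BF n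
(f ⊕ g) v = f v xor g v

_⊙_ : ∀ {n} → BF n → BF n → BF n
(f ⊙ g) v = f v ∧ g v

IndepOf : ∀ {n} → BF n → Fin n → Set
IndepOf f i = ∀ v b → f (v [ i ]≔ b) ≡ f v

-- Algebraic normal form: a polynomial over GF(2) in n variables is given
-- by its coefficient function on monomials; a monomial ∏_{k∈S} x_k is
-- identified with the subset S ⊆ V.

ANF : ℕ → Set
ANF n = Subset n → Bool

allSubsets : ∀ n → List (Subset n)
allSubsets zero    = [] ∷ []
allSubsets (suc n) = map (false ∷_) (allSubsets n) ++ map (true ∷_) (allSubsets n)

monomial : ∀ {n} → Subset n → Vec Bool n → Bool
monomial []          []       = true
monomial (s ∷ S)     (x ∷ v)  = (not s ∨ x) ∧ monomial S v

evalANF : ∀ {n} → ANF n → BF n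
evalANF {n} c v = foldr (λ S acc → (c S ∧ monomial S v) xor acc) false (allSubsets n)

IsANFOf : ∀ {n} → ANF n → BF n → Set
IsANFOf c f = ∀ v → evalANF c v ≡ f v

DegLe2 : ∀ {n} → ANF n → Set
DegLe2 c = ∀ S → c S ≡ true → ∣ S ∣ ≤ 2

QuadPartIs : ∀ {n} → ANF n → (Fin n → Fin n → Bool) → Set
QuadPartIs c E = ∀ a b → a ≢ b → c (⁅ a ⁆ ∪ ⁅ b ⁆) ≡ E a b

_==_ : ∀ {n} → Fin n → Fin n → Bool
a == b = does (a ≟ b)

swap : ∀ {n} → Fin n → Fin n → Fin n → Fin n
swap i j x = if x == i then j else (if x == j then i else x)

-- Adjacency after the toggling step (before relabelling).
-- x,y ∈ V∖{i,j}; x lies in one of the first three classes iff it is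
-- adjacent to i or j, and its class is determined by (adj i x, adj j x).
toggled : ∀ {n} → Graph n → Fin n → Fin n → Fin n → Fin n → Bool
toggled G i j x y =
  adj G x y xor
    ( not (x == i) ∧ not (x == j) ∧ not (y == i) ∧ not (y == j)
    ∧ (adj G i x ∨ adj G j x) ∧ (adj G i y ∨ adj G j y)
    ∧ ((adj G i x xor adj G i y) ∨ (adj G j x xor adj G j y)) )

pivotAdj : ∀ {n} → Graph n → Fin n → Fin n → Fin n → Fin n → Bool
pivotAdj G i j x y = toggled G i j (swap i j x) (swap i j y)

decomp : ∀ {n} → Fin n → Fin n → BF n → BF n → BF n → BF n
decomp i j Ni Nj R = var i ⊙ var j ⊕ var i ⊙ Ni ⊕ var j ⊙ Nj ⊕ R

p-iji : ∀ {n} → Fin n → Fin n → BF n → BF n → BF n → BF n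
p-iji i j Ni Nj R = var i ⊙ var j ⊕ var i ⊙ Nj ⊕ var j ⊙ Ni ⊕ Ni ⊙ Nj ⊕ R

-- The coefficient of x_a x_b in the algebraic normal form of f is the second derivative
-- ∂_b ∂_a f at the origin, where ∂_a f(v) = f(v[a := 1]) + f(v[a := 0]); indeed ∂_a acts on
-- coefficients by c ↦ (S ↦ [a ∉ S] c_{S ∪ {a}}). As N_i, N_j, R do not involve x_i, x_j,
-- ∂_i p = x_j + N_i and ∂_i p_iji = x_j + N_j (and symmetrically in i, j). Hence for a ∉ {i, j}
-- the coefficient of x_i x_a in p_iji is ∂_a N_j(0), the coefficient of x_j x_a in p, and that of
-- x_i x_j is 1. For a, b ∉ {i, j} it is the coefficient of x_a x_b in R plus ∂_b ∂_a (N_i N_j)(0).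
-- Since p has degree 2, ∂_b ∂_a ∂_i p = ∂_b ∂_a N_i vanishes, so N_i and N_j are affine on the
-- square spanned by a and b, and then ∂_b ∂_a (N_i N_j)(0) = ∂_a N_i ∂_b N_j + ∂_a N_j ∂_b N_i,
-- the determinant of the vectors (E(i,a), E(j,a)) and (E(i,b), E(j,b)) of GF(2)². The pivot
-- toggles ab exactly when these vectors are nonzero and distinct, i.e. when the determinant is 1.
module Submission where

open import Defs
open import Data.Bool using (Bool; true)
open import Data.Fin using (Fin)
open import Data.Fin.Subset using (⁅_⁆; _∪_)
open import Relation.Binary.PropositionalEquality using (_≡_; _≢_)

open import Algebra.Bundles using (CommutativeMonoid; CommutativeRing)
open import Data.Bool using (false; not; _∧_; _∨_; _xor_; if_then_else_)
open import Data.Bool.Properties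
  using (∧-commutativeMonoid; xor-∧-commutativeRing; ∧-distribˡ-xor; ∧-zeroʳ; ∧-identityʳ;
         xor-assoc; xor-comm; xor-same; xor-identityʳ)
  renaming (_≟_ to _≟ᵇ_)
open import Data.Fin using (zero; suc; _≟_)
open import Data.Fin.Subset using (Subset; ⊥; ∣_∣)
open import Data.Fin.Subset.Properties using (∪-identityˡ; ∪-identityʳ; ∪-comm; ∣⊥∣≡0)
open import Data.List using (List; foldr; map; _++_)
open import Data.List.Properties using (foldr-++; foldr-map; foldr-fusion; foldr-cong)
open import Data.Nat using (ℕ; zero; suc; _≤_; s≤s)
open import Data.Product using (_,_)
open import Data.Vec using (Vec; []; _∷_; lookup; _[_]≔_)
open import Data.Vec.Properties using (lookup∘update; lookup∘update′; lookup-replicate; []≔-lookup)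
open import Function using (_∘_)
open import Relation.Binary.PropositionalEquality
  using (refl; trans; cong; cong₂; subst; _≗_; ≢-sym; module ≡-Reasoning)
import Relation.Binary.PropositionalEquality as ≡
open import Relation.Nullary using (Dec; yes; no; map′; _×-dec_; contradiction)
open import Relation.Nullary.Decidable using (True; toWitness; dec-true; dec-false)

open import Algebra.Properties.CommutativeSemigroup
  (CommutativeRing.+-commutativeSemigroup xor-∧-commutativeRing) using (interchange)
open import Algebra.Properties.CommutativeSemigroup
  (CommutativeMonoid.commutativeSemigroup ∧-commutativeMonoid) using (x∙yz≈y∙xz)
open import Algebra.Properties.AbelianGroup
  (CommutativeRing.+-abelianGroup xor-∧-commutativeRing) using (xyx⁻¹≈y)

open ≡-Reasoning

BoolOp : ℕ → Set
BoolOp zero    = Bool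
BoolOp (suc k) = Bool → BoolOp k

Pointwise-≡ : ∀ k → BoolOp k → BoolOp k → Set
Pointwise-≡ zero    x y = x ≡ y
Pointwise-≡ (suc k) f g = ∀ x → Pointwise-≡ k (f x) (g x)

pointwise-≡? : ∀ k (f g : BoolOp k) → Dec (Pointwise-≡ k f g)
pointwise-≡? zero    x y = x ≟ᵇ y
pointwise-≡? (suc k) f g =
  map′ (λ { (f₀ , f₁) false → f₀ ; (f₀ , f₁) true → f₁ }) (λ h → h false , h true)
       (pointwise-≡? k (f false) (g false) ×-dec pointwise-≡? k (f true) (g true))

by-evaluation : ∀ k {f g : BoolOp k} → {True (pointwise-≡? k f g)} → Pointwise-≡ k f g
by-evaluation k {f} {g} {t} = toWitness t

nonzero-distinct≡det : Pointwise-≡ 4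
  (λ u₁ u₂ w₁ w₂ → (u₁ ∨ u₂) ∧ (w₁ ∨ w₂) ∧ ((u₁ xor w₁) ∨ (u₂ xor w₂)))
  (λ u₁ u₂ w₁ w₂ → u₁ ∧ w₂ xor u₂ ∧ w₁)
nonzero-distinct≡det = by-evaluation 4

second-difference-∧ : Pointwise-≡ 8
  (λ f₁₁ f₀₁ f₁₀ f₀₀ g₁₁ g₀₁ g₁₀ g₀₀ →
     (f₁₁ ∧ g₁₁ xor f₀₁ ∧ g₀₁) xor (f₁₀ ∧ g₁₀ xor f₀₀ ∧ g₀₀))
  (λ f₁₁ f₀₁ f₁₀ f₀₀ g₁₁ g₀₁ g₁₀ g₀₀ →
     let Δf = (f₁₁ xor f₀₁) xor (f₁₀ xor f₀₀)
         Δg = (g₁₁ xor g₀₁) xor (g₁₀ xor g₀₀)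
     in ((f₁₀ xor f₀₀) ∧ (g₀₁ xor g₀₀) xor (g₁₀ xor g₀₀) ∧ (f₀₁ xor f₀₀))
        xor (Δf ∧ g₁₁ xor Δg ∧ f₁₁ xor Δf ∧ Δg))
second-difference-∧ = by-evaluation 8

-- Discrete derivatives

∂ : ∀ {n} → Fin n → BF n → BF n
∂ a f v = f (v [ a ]≔ true) xor f (v [ a ]≔ false)

-- Points of GF(2)ⁿ and subsets of V are both Vec Bool n; the empty subset ⊥ is the origin.
lookup-⊥ : ∀ {n} (a : Fin n) → lookup ⊥ a ≡ false
lookup-⊥ a = lookup-replicate a false

∂-var : ∀ {n} (a : Fin n) v → ∂ a (var a) v ≡ true
∂-var a v = cong₂ _xor_ (lookup∘update a v true) (lookup∘update a v false)

module _ {n} {a : Fin n} where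

  IndepOf-var : ∀ {k} → k ≢ a → IndepOf (var k) a
  IndepOf-var k≢a v = lookup∘update′ k≢a v

  IndepOf-⊙ : ∀ {f g : BF n} → IndepOf f a → IndepOf g a → IndepOf (f ⊙ g) a
  IndepOf-⊙ f⊥a g⊥a v x = cong₂ _∧_ (f⊥a v x) (g⊥a v x)

  ∂-cong : ∀ {f g : BF n} → f ≗ g → ∂ a f ≗ ∂ a g
  ∂-cong f≗g v = cong₂ _xor_ (f≗g _) (f≗g _)

  ∂-⊕ : ∀ (f g : BF n) → ∂ a (f ⊕ g) ≗ ∂ a f ⊕ ∂ a g
  ∂-⊕ f g v = interchange (f _) (g _) (f _) (g _)

  ∂-⊕-≗ : ∀ (f g : BF n) {f′ g′} → ∂ a f ≗ f′ → ∂ a g ≗ g′ → ∂ a (f ⊕ g) ≗ f′ ⊕ g′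
  ∂-⊕-≗ f g ∂f≗f′ ∂g≗g′ v = trans (∂-⊕ f g v) (cong₂ _xor_ (∂f≗f′ v) (∂g≗g′ v))

  ∂-indep : ∀ {f : BF n} → IndepOf f a → ∀ v → ∂ a f v ≡ false
  ∂-indep {f} f⊥a v = trans (cong₂ _xor_ (f⊥a v true) (f⊥a v false)) (xor-same (f v))

  ∂-var-⊕ : ∀ {k} (f : BF n) → k ≢ a → ∂ a (var k ⊕ f) ≗ ∂ a f
  ∂-var-⊕ {k} f k≢a v =
    trans (∂-⊕ (var k) f v) (cong (_xor ∂ a f v) (∂-indep (IndepOf-var k≢a) v))

  ∂-var-⊙ : ∀ {g : BF n} → IndepOf g a → ∂ a (var a ⊙ g) ≗ g
  ∂-var-⊙ {g} g⊥a v = begin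
    lookup v₁ a ∧ g v₁ xor lookup v₀ a ∧ g v₀
      ≡⟨ cong₂ (λ x y → x ∧ g v₁ xor y ∧ g v₀) (lookup∘update a v true) (lookup∘update a v false) ⟩
    g v₁ xor false  ≡⟨ xor-identityʳ (g v₁) ⟩
    g v₁            ≡⟨ g⊥a v true ⟩
    g v             ∎
    where
    v₁ v₀ : Vec Bool n
    v₁ = v [ a ]≔ true
    v₀ = v [ a ]≔ false

  ∂-⊙-indep : ∀ {f : BF n} (g : BF n) → IndepOf f a → ∂ a (f ⊙ g) ≗ f ⊙ ∂ a g
  ∂-⊙-indep {f} g f⊥a v = begin
    f v₁ ∧ g v₁ xor f v₀ ∧ g v₀
      ≡⟨ cong₂ (λ x y → x ∧ g v₁ xor y ∧ g v₀) (f⊥a v true) (f⊥a v false) ⟩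
    f v ∧ g v₁ xor f v ∧ g v₀  ≡⟨ ≡.sym (∧-distribˡ-xor (f v) (g v₁) (g v₀)) ⟩
    f v ∧ ∂ a g v              ∎
    where
    v₁ v₀ : Vec Bool n
    v₁ = v [ a ]≔ true
    v₀ = v [ a ]≔ false

  ∂-at : ∀ (f : BF n) {v} → lookup v a ≡ false → ∂ a f v ≡ f (v [ a ]≔ true) xor f v
  ∂-at f {v} va≡0 = cong (λ w → f (v [ a ]≔ true) xor f w)
                         (trans (cong (v [ a ]≔_) (≡.sym va≡0)) ([]≔-lookup v a))

module _ {n} {a b : Fin n} where

  ∂∂-⊕ : ∀ (f g : BF n) → ∂ b (∂ a (f ⊕ g)) ≗ ∂ b (∂ a f) ⊕ ∂ b (∂ a g)
  ∂∂-⊕ f g v = trans (∂-cong (∂-⊕ f g) v) (∂-⊕ (∂ a f) (∂ a g) v)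

  ∂∂-⊕-vanish-at-⊥ : ∀ (f g : BF n) → ∂ b (∂ a f) ⊥ ≡ false → ∂ b (∂ a g) ⊥ ≡ false →
    ∂ b (∂ a (f ⊕ g)) ⊥ ≡ false
  ∂∂-⊕-vanish-at-⊥ f g ∂∂f≡0 ∂∂g≡0 = trans (∂∂-⊕ f g ⊥) (cong₂ _xor_ ∂∂f≡0 ∂∂g≡0)

  ∂∂-var-⊙-at-⊥ : ∀ {k} (f : BF n) → k ≢ a → k ≢ b → ∂ b (∂ a (var k ⊙ f)) ⊥ ≡ false
  ∂∂-var-⊙-at-⊥ {k} f k≢a k≢b = begin
    ∂ b (∂ a (var k ⊙ f)) ⊥    ≡⟨ ∂-cong (∂-⊙-indep f (IndepOf-var k≢a)) ⊥ ⟩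
    ∂ b (var k ⊙ ∂ a f) ⊥      ≡⟨ ∂-⊙-indep (∂ a f) (IndepOf-var k≢b) ⊥ ⟩
    lookup ⊥ k ∧ ∂ b (∂ a f) ⊥ ≡⟨ cong (_∧ ∂ b (∂ a f) ⊥) (lookup-⊥ k) ⟩
    false                      ∎

  ∂∂-at-⊥ : ∀ (h : BF n) → a ≢ b →
    ∂ b (∂ a h) ⊥ ≡ (h ((⊥ [ b ]≔ true) [ a ]≔ true) xor h (⊥ [ b ]≔ true))
                    xor (h (⊥ [ a ]≔ true) xor h ⊥)
  ∂∂-at-⊥ h a≢b =
    trans (∂-at (∂ a h) (lookup-⊥ b))
          (cong₂ _xor_ (∂-at h (trans (lookup∘update′ a≢b ⊥ true) (lookup-⊥ a)))
                       (∂-at h (lookup-⊥ a)))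

  ∂∂-⊙-at-⊥ : ∀ (f g : BF n) → a ≢ b → ∂ b (∂ a f) ⊥ ≡ false → ∂ b (∂ a g) ⊥ ≡ false →
    ∂ b (∂ a (f ⊙ g)) ⊥ ≡ ∂ a f ⊥ ∧ ∂ b g ⊥ xor ∂ a g ⊥ ∧ ∂ b f ⊥
  ∂∂-⊙-at-⊥ f g a≢b ∂∂f≡0 ∂∂g≡0 = begin
    ∂ b (∂ a (f ⊙ g)) ⊥
      ≡⟨ ∂∂-at-⊥ (f ⊙ g) a≢b ⟩
    (f p₁₁ ∧ g p₁₁ xor f p₀₁ ∧ g p₀₁) xor (f p₁₀ ∧ g p₁₀ xor f p₀₀ ∧ g p₀₀)
      ≡⟨ second-difference-∧ (f p₁₁) (f p₀₁) (f p₁₀) (f p₀₀) (g p₁₁) (g p₀₁) (g p₁₀) (g p₀₀) ⟩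
    cross xor (Δf ∧ g p₁₁ xor Δg ∧ f p₁₁ xor Δf ∧ Δg)
      ≡⟨ cong₂ (λ x y → cross xor (x ∧ g p₁₁ xor y ∧ f p₁₁ xor x ∧ y))
               (trans (≡.sym (∂∂-at-⊥ f a≢b)) ∂∂f≡0) (trans (≡.sym (∂∂-at-⊥ g a≢b)) ∂∂g≡0) ⟩
    cross xor false
      ≡⟨ xor-identityʳ cross ⟩
    cross
      ≡⟨ ≡.sym (cong₂ _xor_ (cong₂ _∧_ (∂-at f (lookup-⊥ a)) (∂-at g (lookup-⊥ b)))
                            (cong₂ _∧_ (∂-at g (lookup-⊥ a)) (∂-at f (lookup-⊥ b)))) ⟩
    ∂ a f ⊥ ∧ ∂ b g ⊥ xor ∂ a g ⊥ ∧ ∂ b f ⊥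
      ∎
    where
    p₀₀ p₁₀ p₀₁ p₁₁ : Vec Bool n
    p₀₀ = ⊥
    p₁₀ = ⊥ [ a ]≔ true
    p₀₁ = ⊥ [ b ]≔ true
    p₁₁ = (⊥ [ b ]≔ true) [ a ]≔ true
    Δf Δg cross : Bool
    Δf = (f p₁₁ xor f p₀₁) xor (f p₁₀ xor f p₀₀)
    Δg = (g p₁₁ xor g p₀₁) xor (g p₁₀ xor g p₀₀)
    cross = (f p₁₀ xor f p₀₀) ∧ (g p₀₁ xor g p₀₀) xor (g p₁₀ xor g p₀₀) ∧ (f p₀₁ xor f p₀₀)

-- Algebraic normal forms

∂ANF : ∀ {n} → Fin n → ANF n → ANF n
∂ANF a c S = not (lookup S a) ∧ c (⁅ a ⁆ ∪ S)

evalANF-∷ : ∀ {n} (c : ANF (suc n)) x v →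
  evalANF c (x ∷ v) ≡ evalANF (c ∘ (false ∷_)) v xor x ∧ evalANF (c ∘ (true ∷_)) v
evalANF-∷ {n} c x v = begin
  foldr step false (map (false ∷_) L ++ map (true ∷_) L)
    ≡⟨ foldr-++ step false (map (false ∷_) L) (map (true ∷_) L) ⟩
  foldr step (foldr step false (map (true ∷_) L)) (map (false ∷_) L)
    ≡⟨ foldr-map step (false ∷_) _ L ⟩
  foldr step₀ (foldr step false (map (true ∷_) L)) L
    ≡⟨ cong (λ z → foldr step₀ z L) (foldr-map step (true ∷_) false L) ⟩
  foldr step₀ (foldr step₁ false L) L
    ≡⟨ ≡.sym (foldr-fusion (_xor foldr step₁ false L) false
                (λ S acc → xor-assoc (c (false ∷ S) ∧ monomial S v) acc _) L) ⟩
  evalANF (c ∘ (false ∷_)) v xor foldr step₁ false L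
    ≡⟨ cong (evalANF (c ∘ (false ∷_)) v xor_) (≡.sym x∧evalANF₁) ⟩
  evalANF (c ∘ (false ∷_)) v xor x ∧ evalANF (c ∘ (true ∷_)) v
    ∎
  where
  L : List (Subset n)
  L = allSubsets n
  step : Subset (suc n) → Bool → Bool
  step S acc = (c S ∧ monomial S (x ∷ v)) xor acc
  step₀ step₁ step₁′ : Subset n → Bool → Bool
  step₀ S acc = (c (false ∷ S) ∧ monomial S v) xor acc
  step₁ S acc = (c (true ∷ S) ∧ x ∧ monomial S v) xor acc
  step₁′ S acc = (c (true ∷ S) ∧ monomial S v) xor acc
  x∧evalANF₁ : x ∧ foldr step₁′ false L ≡ foldr step₁ false L
  x∧evalANF₁ = trans (foldr-fusion (x ∧_) false fuse L) (cong (λ z → foldr step₁ z L) (∧-zeroʳ x))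
    where
    fuse : ∀ S acc → x ∧ step₁′ S acc ≡ step₁ S (x ∧ acc)
    fuse S acc = trans (∧-distribˡ-xor x (c (true ∷ S) ∧ monomial S v) acc)
                       (cong (_xor (x ∧ acc)) (x∙yz≈y∙xz x (c (true ∷ S)) (monomial S v)))

evalANF-cong : ∀ {n} {c c′ : ANF n} → (∀ S → c S ≡ c′ S) → evalANF c ≗ evalANF c′
evalANF-cong {n} c≗c′ v =
  foldr-cong (λ S acc → cong (λ b → (b ∧ monomial S v) xor acc) (c≗c′ S)) refl (allSubsets n)

evalANF-zero : ∀ {n} (v : Vec Bool n) → evalANF (λ _ → false) v ≡ false
evalANF-zero []      = refl
evalANF-zero (x ∷ v) = begin
  evalANF (λ _ → false) (x ∷ v)
    ≡⟨ evalANF-∷ (λ _ → false) x v ⟩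
  evalANF (λ _ → false) v xor x ∧ evalANF (λ _ → false) v
    ≡⟨ cong₂ (λ p q → p xor x ∧ q) (evalANF-zero v) (evalANF-zero v) ⟩
  x ∧ false
    ≡⟨ ∧-zeroʳ x ⟩
  false
    ∎

evalANF-⊥ : ∀ {n} (c : ANF n) → evalANF c ⊥ ≡ c ⊥
evalANF-⊥ {zero}  c = trans (xor-identityʳ _) (∧-identityʳ _)
evalANF-⊥ {suc n} c =
  trans (evalANF-∷ c false ⊥) (trans (xor-identityʳ _) (evalANF-⊥ (c ∘ (false ∷_))))

evalANF-∂ : ∀ {n} (a : Fin n) (c : ANF n) → ∂ a (evalANF c) ≗ evalANF (∂ANF a c)
evalANF-∂ zero c (x ∷ v) = begin
  evalANF c (true ∷ v) xor evalANF c (false ∷ v)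
    ≡⟨ cong₂ _xor_ (evalANF-∷ c true v) (evalANF-∷ c false v) ⟩
  (E₀ xor E₁) xor (E₀ xor false)
    ≡⟨ cong ((E₀ xor E₁) xor_) (xor-identityʳ E₀) ⟩
  (E₀ xor E₁) xor E₀
    ≡⟨ xyx⁻¹≈y E₀ E₁ ⟩
  E₁
    ≡⟨ evalANF-cong (λ S → cong (c ∘ (true ∷_)) (≡.sym (∪-identityˡ S))) v ⟩
  evalANF (∂ANF zero c ∘ (false ∷_)) v
    ≡⟨ ≡.sym (xor-identityʳ _) ⟩
  evalANF (∂ANF zero c ∘ (false ∷_)) v xor false
    ≡⟨ cong (evalANF (∂ANF zero c ∘ (false ∷_)) v xor_)
            (≡.sym (trans (cong (x ∧_) (evalANF-zero v)) (∧-zeroʳ x))) ⟩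
  evalANF (∂ANF zero c ∘ (false ∷_)) v xor x ∧ evalANF (∂ANF zero c ∘ (true ∷_)) v
    ≡⟨ ≡.sym (evalANF-∷ (∂ANF zero c) x v) ⟩
  evalANF (∂ANF zero c) (x ∷ v)
    ∎
  where
  E₀ E₁ : Bool
  E₀ = evalANF (c ∘ (false ∷_)) v
  E₁ = evalANF (c ∘ (true ∷_)) v
evalANF-∂ (suc a) c (x ∷ v) = begin
  evalANF c (x ∷ v₁) xor evalANF c (x ∷ v₀)
    ≡⟨ cong₂ _xor_ (evalANF-∷ c x v₁) (evalANF-∷ c x v₀) ⟩
  (evalANF c₀ v₁ xor x ∧ evalANF c₁ v₁) xor (evalANF c₀ v₀ xor x ∧ evalANF c₁ v₀)
    ≡⟨ interchange (evalANF c₀ v₁) (x ∧ evalANF c₁ v₁) (evalANF c₀ v₀) (x ∧ evalANF c₁ v₀) ⟩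
  ∂ a (evalANF c₀) v xor (x ∧ evalANF c₁ v₁ xor x ∧ evalANF c₁ v₀)
    ≡⟨ cong (∂ a (evalANF c₀) v xor_) (≡.sym (∧-distribˡ-xor x _ _)) ⟩
  ∂ a (evalANF c₀) v xor x ∧ ∂ a (evalANF c₁) v
    ≡⟨ cong₂ (λ p q → p xor x ∧ q) (evalANF-∂ a c₀ v) (evalANF-∂ a c₁ v) ⟩
  evalANF (∂ANF a c₀) v xor x ∧ evalANF (∂ANF a c₁) v
    ≡⟨ ≡.sym (evalANF-∷ (∂ANF (suc a) c) x v) ⟩
  evalANF (∂ANF (suc a) c) (x ∷ v)
    ∎
  where
  v₁ v₀ : Vec Bool _
  v₁ = v [ a ]≔ true
  v₀ = v [ a ]≔ false
  c₀ c₁ : ANF _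
  c₀ = c ∘ (false ∷_)
  c₁ = c ∘ (true ∷_)

IsANFOf-∂ : ∀ {n} (a : Fin n) (c : ANF n) {f : BF n} →
  IsANFOf c f → IsANFOf (∂ANF a c) (∂ a f)
IsANFOf-∂ a c c≗f v = trans (≡.sym (evalANF-∂ a c v)) (∂-cong c≗f v)

constant-coefficient : ∀ {n} (c : ANF n) {f : BF n} → IsANFOf c f → c ⊥ ≡ f ⊥
constant-coefficient c c≗f = trans (≡.sym (evalANF-⊥ c)) (c≗f ⊥)

lookup-⁅⁆∪ : ∀ {n} {a b : Fin n} (S : Subset n) → b ≢ a → lookup (⁅ a ⁆ ∪ S) b ≡ lookup S b
lookup-⁅⁆∪ {a = zero}  {zero}  _       b≢a = contradiction refl b≢a
lookup-⁅⁆∪ {a = zero}  {suc b} (_ ∷ S) _   = cong (λ T → lookup T b) (∪-identityˡ S)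
lookup-⁅⁆∪ {a = suc a} {zero}  (_ ∷ S) _   = refl
lookup-⁅⁆∪ {a = suc a} {suc b} (_ ∷ S) b≢a = lookup-⁅⁆∪ S (b≢a ∘ cong suc)

∣⁅⁆∪∣ : ∀ {n} (a : Fin n) (S : Subset n) → lookup S a ≡ false → ∣ ⁅ a ⁆ ∪ S ∣ ≡ suc ∣ S ∣
∣⁅⁆∪∣ zero    (false ∷ S) _    = cong (suc ∘ ∣_∣) (∪-identityˡ S)
∣⁅⁆∪∣ (suc a) (false ∷ S) Sa≡0 = ∣⁅⁆∪∣ a S Sa≡0
∣⁅⁆∪∣ (suc a) (true ∷ S)  Sa≡0 = cong suc (∣⁅⁆∪∣ a S Sa≡0)

∂ANF-⁅⁆∪ : ∀ {n} (a : Fin n) c S → lookup S a ≡ false → ∂ANF a c S ≡ c (⁅ a ⁆ ∪ S)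
∂ANF-⁅⁆∪ a c S Sa≡0 = cong (λ x → not x ∧ c (⁅ a ⁆ ∪ S)) Sa≡0

coefficient-pair : ∀ {n} (c : ANF n) {f : BF n} {a b : Fin n} →
  IsANFOf c f → a ≢ b → c (⁅ a ⁆ ∪ ⁅ b ⁆) ≡ ∂ b (∂ a f) ⊥
coefficient-pair c {f} {a} {b} c≗f a≢b = begin
  c (⁅ a ⁆ ∪ ⁅ b ⁆)
    ≡⟨ cong (λ T → c (⁅ a ⁆ ∪ T)) (≡.sym (∪-identityʳ ⁅ b ⁆)) ⟩
  c (⁅ a ⁆ ∪ (⁅ b ⁆ ∪ ⊥))
    ≡⟨ ≡.sym (∂ANF-⁅⁆∪ a c (⁅ b ⁆ ∪ ⊥) (trans (lookup-⁅⁆∪ ⊥ a≢b) (lookup-⊥ a))) ⟩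
  ∂ANF a c (⁅ b ⁆ ∪ ⊥)
    ≡⟨ ≡.sym (∂ANF-⁅⁆∪ b (∂ANF a c) ⊥ (lookup-⊥ b)) ⟩
  ∂ANF b (∂ANF a c) ⊥
    ≡⟨ constant-coefficient (∂ANF b (∂ANF a c)) (IsANFOf-∂ b (∂ANF a c) (IsANFOf-∂ a c c≗f)) ⟩
  ∂ b (∂ a f) ⊥
    ∎

coefficient-beyond-degree : ∀ {n} {c : ANF n} {S} → DegLe2 c → ∣ S ∣ ≡ 3 → c S ≡ false
coefficient-beyond-degree {c = c} {S} deg ∣S∣≡3 with c S in cS≡1
... | false = refl
... | true  = contradiction (subst (_≤ 2) ∣S∣≡3 (deg S cS≡1)) λ { (s≤s (s≤s ())) }

∂∂∂-vanish-at-⊥ : ∀ {n} (c : ANF n) {f : BF n} {a b k : Fin n} →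
  IsANFOf c f → DegLe2 c → a ≢ b → k ≢ a → k ≢ b → ∂ b (∂ a (∂ k f)) ⊥ ≡ false
∂∂∂-vanish-at-⊥ {n} c {f} {a} {b} {k} c≗f deg a≢b k≢a k≢b = begin
  ∂ b (∂ a (∂ k f)) ⊥
    ≡⟨ ≡.sym (constant-coefficient (∂ANF b (∂ANF a (∂ANF k c)))
         (IsANFOf-∂ b (∂ANF a (∂ANF k c)) (IsANFOf-∂ a (∂ANF k c) (IsANFOf-∂ k c c≗f)))) ⟩
  ∂ANF b (∂ANF a (∂ANF k c)) ⊥
    ≡⟨ ∂ANF-⁅⁆∪ b (∂ANF a (∂ANF k c)) ⊥ (lookup-⊥ b) ⟩
  ∂ANF a (∂ANF k c) (⁅ b ⁆ ∪ ⊥)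
    ≡⟨ ∂ANF-⁅⁆∪ a (∂ANF k c) (⁅ b ⁆ ∪ ⊥) a∉b ⟩
  ∂ANF k c (⁅ a ⁆ ∪ (⁅ b ⁆ ∪ ⊥))
    ≡⟨ ∂ANF-⁅⁆∪ k c (⁅ a ⁆ ∪ (⁅ b ⁆ ∪ ⊥)) k∉ab ⟩
  c (⁅ k ⁆ ∪ (⁅ a ⁆ ∪ (⁅ b ⁆ ∪ ⊥)))
    ≡⟨ coefficient-beyond-degree deg ∣kab∣≡3 ⟩
  false
    ∎
  where
  a∉b : lookup (⁅ b ⁆ ∪ ⊥) a ≡ false
  a∉b = trans (lookup-⁅⁆∪ ⊥ a≢b) (lookup-⊥ a)
  k∉ab : lookup (⁅ a ⁆ ∪ (⁅ b ⁆ ∪ ⊥)) k ≡ false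
  k∉ab = trans (lookup-⁅⁆∪ (⁅ b ⁆ ∪ ⊥) k≢a) (trans (lookup-⁅⁆∪ ⊥ k≢b) (lookup-⊥ k))
  ∣kab∣≡3 : ∣ ⁅ k ⁆ ∪ (⁅ a ⁆ ∪ (⁅ b ⁆ ∪ ⊥)) ∣ ≡ 3
  ∣kab∣≡3 = trans (∣⁅⁆∪∣ k (⁅ a ⁆ ∪ (⁅ b ⁆ ∪ ⊥)) k∉ab)
              (cong suc (trans (∣⁅⁆∪∣ a (⁅ b ⁆ ∪ ⊥) a∉b)
                (cong suc (trans (∣⁅⁆∪∣ b ⊥ (lookup-⊥ b)) (cong suc (∣⊥∣≡0 n))))))


decomp-swap : ∀ {n} (i j : Fin n) (Ni Nj R : BF n) → decomp i j Ni Nj R ≗ decomp j i Nj Ni R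
decomp-swap i j Ni Nj R v = swap-roles (lookup v i) (lookup v j) (Ni v) (Nj v) (R v)
  where
  swap-roles : Pointwise-≡ 5
    (λ xᵢ xⱼ nᵢ nⱼ r → ((xᵢ ∧ xⱼ xor xᵢ ∧ nᵢ) xor xⱼ ∧ nⱼ) xor r)
    (λ xᵢ xⱼ nᵢ nⱼ r → ((xⱼ ∧ xᵢ xor xⱼ ∧ nⱼ) xor xᵢ ∧ nᵢ) xor r)
  swap-roles = by-evaluation 5

p-iji-swap : ∀ {n} (i j : Fin n) (Ni Nj R : BF n) → p-iji i j Ni Nj R ≗ p-iji j i Nj Ni R
p-iji-swap i j Ni Nj R v = swap-roles (lookup v i) (lookup v j) (Ni v) (Nj v) (R v)
  where
  swap-roles : Pointwise-≡ 5
    (λ xᵢ xⱼ nᵢ nⱼ r → (((xᵢ ∧ xⱼ xor xᵢ ∧ nⱼ) xor xⱼ ∧ nᵢ) xor nᵢ ∧ nⱼ) xor r)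
    (λ xᵢ xⱼ nᵢ nⱼ r → (((xⱼ ∧ xᵢ xor xⱼ ∧ nᵢ) xor xᵢ ∧ nⱼ) xor nⱼ ∧ nᵢ) xor r)
  swap-roles = by-evaluation 5

module _ {n} {i j : Fin n} {Ni Nj R : BF n} (j≢i : j ≢ i)
         (Ni⊥i : IndepOf Ni i) (Nj⊥i : IndepOf Nj i) (R⊥i : IndepOf R i) where

  ∂-decomp : ∂ i (decomp i j Ni Nj R) ≗ var j ⊕ Ni
  ∂-decomp v = trans
    (∂-⊕-≗ (var i ⊙ var j ⊕ var i ⊙ Ni ⊕ var j ⊙ Nj) R
      (∂-⊕-≗ (var i ⊙ var j ⊕ var i ⊙ Ni) (var j ⊙ Nj)
        (∂-⊕-≗ (var i ⊙ var j) (var i ⊙ Ni) (∂-var-⊙ (IndepOf-var j≢i)) (∂-var-⊙ Ni⊥i))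
        (∂-indep (IndepOf-⊙ (IndepOf-var j≢i) Nj⊥i)))
      (∂-indep R⊥i) v)
    (trans (xor-identityʳ _) (xor-identityʳ _))

  ∂-p-iji : ∂ i (p-iji i j Ni Nj R) ≗ var j ⊕ Nj
  ∂-p-iji v = trans
    (∂-⊕-≗ (var i ⊙ var j ⊕ var i ⊙ Nj ⊕ var j ⊙ Ni ⊕ Ni ⊙ Nj) R
      (∂-⊕-≗ (var i ⊙ var j ⊕ var i ⊙ Nj ⊕ var j ⊙ Ni) (Ni ⊙ Nj)
        (∂-⊕-≗ (var i ⊙ var j ⊕ var i ⊙ Nj) (var j ⊙ Ni)
          (∂-⊕-≗ (var i ⊙ var j) (var i ⊙ Nj) (∂-var-⊙ (IndepOf-var j≢i)) (∂-var-⊙ Nj⊥i))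
          (∂-indep (IndepOf-⊙ (IndepOf-var j≢i) Ni⊥i)))
        (∂-indep (IndepOf-⊙ Ni⊥i Nj⊥i)))
      (∂-indep R⊥i) v)
    (trans (xor-identityʳ _) (trans (xor-identityʳ _) (xor-identityʳ _)))

module _ {n} {a b i j : Fin n} (Ni Nj R : BF n)
         (i≢a : i ≢ a) (i≢b : i ≢ b) (j≢a : j ≢ a) (j≢b : j ≢ b) where

  ∂∂-decomp-at-⊥ : ∂ b (∂ a (decomp i j Ni Nj R)) ⊥ ≡ ∂ b (∂ a R) ⊥
  ∂∂-decomp-at-⊥ = trans (∂∂-⊕ (var i ⊙ var j ⊕ var i ⊙ Ni ⊕ var j ⊙ Nj) R ⊥)
    (cong (_xor ∂ b (∂ a R) ⊥)
      (∂∂-⊕-vanish-at-⊥ (var i ⊙ var j ⊕ var i ⊙ Ni) (var j ⊙ Nj)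
        (∂∂-⊕-vanish-at-⊥ (var i ⊙ var j) (var i ⊙ Ni)
          (∂∂-var-⊙-at-⊥ (var j) i≢a i≢b) (∂∂-var-⊙-at-⊥ Ni i≢a i≢b))
        (∂∂-var-⊙-at-⊥ Nj j≢a j≢b)))

  ∂∂-p-iji-at-⊥ : ∂ b (∂ a (p-iji i j Ni Nj R)) ⊥ ≡ ∂ b (∂ a (Ni ⊙ Nj)) ⊥ xor ∂ b (∂ a R) ⊥
  ∂∂-p-iji-at-⊥ = trans (∂∂-⊕ (var i ⊙ var j ⊕ var i ⊙ Nj ⊕ var j ⊙ Ni ⊕ Ni ⊙ Nj) R ⊥)
    (cong (_xor ∂ b (∂ a R) ⊥)
      (trans (∂∂-⊕ (var i ⊙ var j ⊕ var i ⊙ Nj ⊕ var j ⊙ Ni) (Ni ⊙ Nj) ⊥)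
        (cong (_xor ∂ b (∂ a (Ni ⊙ Nj)) ⊥)
          (∂∂-⊕-vanish-at-⊥ (var i ⊙ var j ⊕ var i ⊙ Nj) (var j ⊙ Ni)
            (∂∂-⊕-vanish-at-⊥ (var i ⊙ var j) (var i ⊙ Nj)
              (∂∂-var-⊙-at-⊥ (var j) i≢a i≢b) (∂∂-var-⊙-at-⊥ Nj i≢a i≢b))
            (∂∂-var-⊙-at-⊥ Ni j≢a j≢b)))))

==-refl : ∀ {n} (x : Fin n) → (x == x) ≡ true
==-refl x = dec-true (x ≟ x) refl

==-≢ : ∀ {n} {x y : Fin n} → x ≢ y → (x == y) ≡ false
==-≢ {x = x} {y} x≢y = dec-false (x ≟ y) x≢y

module _ {n} (G : Graph n) {i j : Fin n} (i≢j : i ≢ j) where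

  private
    j≢i : j ≢ i
    j≢i = ≢-sym i≢j

  swap-i : swap i j i ≡ j
  swap-i = cong (λ b → if b then j else (if i == j then i else i)) (==-refl i)

  swap-j : swap i j j ≡ i
  swap-j = trans (cong (λ b → if b then j else (if j == j then i else j)) (==-≢ j≢i))
                 (cong (λ b → if b then i else j) (==-refl j))

  swap-off : ∀ {x} → x ≢ i → x ≢ j → swap i j x ≡ x
  swap-off {x} x≢i x≢j = trans (cong (λ b → if b then j else (if x == j then i else x)) (==-≢ x≢i))
                              (cong (λ b → if b then i else x) (==-≢ x≢j))

  in-distinct-classes : Fin n → Fin n → Bool
  in-distinct-classes x y = (adj G i x ∨ adj G j x) ∧ (adj G i y ∨ adj G j y)
                          ∧ ((adj G i x xor adj G i y) ∨ (adj G j x xor adj G j y))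

  pivotAdj-unfold : ∀ x y {x′ y′ e₁ e₂ e₃ e₄} → swap i j x ≡ x′ → swap i j y ≡ y′ →
    (x′ == i) ≡ e₁ → (x′ == j) ≡ e₂ → (y′ == i) ≡ e₃ → (y′ == j) ≡ e₄ →
    pivotAdj G i j x y ≡ adj G x′ y′ xor (not e₁ ∧ not e₂ ∧ not e₃ ∧ not e₄ ∧ in-distinct-classes x′ y′)
  pivotAdj-unfold _ _ refl refl refl refl refl refl = refl

  pivot-i-j : pivotAdj G i j i j ≡ adj G i j
  pivot-i-j = trans (pivotAdj-unfold i j swap-i swap-j (==-≢ j≢i) (==-refl j) refl refl)
                    (trans (xor-identityʳ _) (sym G j i))

  pivot-j-i : pivotAdj G i j j i ≡ adj G i j
  pivot-j-i = trans (pivotAdj-unfold j i swap-j swap-i (==-refl i) refl refl refl) (xor-identityʳ _)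

  module _ {a : Fin n} (a≢i : a ≢ i) (a≢j : a ≢ j) where

    pivot-i-off : pivotAdj G i j i a ≡ adj G j a
    pivot-i-off = trans (pivotAdj-unfold i a swap-i (swap-off a≢i a≢j) (==-≢ j≢i) (==-refl j) refl refl)
                        (xor-identityʳ _)

    pivot-off-i : pivotAdj G i j a i ≡ adj G j a
    pivot-off-i =
      trans (pivotAdj-unfold a i (swap-off a≢i a≢j) swap-i (==-≢ a≢i) (==-≢ a≢j) (==-≢ j≢i) (==-refl j))
            (trans (xor-identityʳ _) (sym G a j))

    pivot-j-off : pivotAdj G i j j a ≡ adj G i a
    pivot-j-off = trans (pivotAdj-unfold j a swap-j (swap-off a≢i a≢j) (==-refl i) refl refl refl)
                        (xor-identityʳ _)

    pivot-off-j : pivotAdj G i j a j ≡ adj G i a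
    pivot-off-j =
      trans (pivotAdj-unfold a j (swap-off a≢i a≢j) swap-j (==-≢ a≢i) (==-≢ a≢j) (==-refl i) refl)
            (trans (xor-identityʳ _) (sym G a i))

  pivot-off-off : ∀ {a b} → a ≢ i → a ≢ j → b ≢ i → b ≢ j →
    pivotAdj G i j a b ≡ adj G a b xor (adj G i a ∧ adj G j b xor adj G j a ∧ adj G i b)
  pivot-off-off {a} {b} a≢i a≢j b≢i b≢j =
    trans (pivotAdj-unfold a b (swap-off a≢i a≢j) (swap-off b≢i b≢j)
                           (==-≢ a≢i) (==-≢ a≢j) (==-≢ b≢i) (==-≢ b≢j))
          (cong (adj G a b xor_) (nonzero-distinct≡det (adj G i a) (adj G j a) (adj G i b) (adj G j b)))

-- Quadratic coefficients of p and p_iji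

module Endpoint-coefficients {n} {i j : Fin n} (j≢i : j ≢ i) {Ni Nj R : BF n}
  (Ni⊥i : IndepOf Ni i) (Nj⊥i : IndepOf Nj i) (R⊥i : IndepOf R i) (Nj⊥j : IndepOf Nj j)
  (P : ANF n) (P-anf : IsANFOf P (decomp i j Ni Nj R)) (P-deg : DegLe2 P)
  (Q : ANF n) (Q-anf : IsANFOf Q (p-iji i j Ni Nj R)) where

  ∂a∂i-decomp : ∀ {a} → j ≢ a → ∂ a (∂ i (decomp i j Ni Nj R)) ≗ ∂ a Ni
  ∂a∂i-decomp j≢a v = trans (∂-cong (∂-decomp j≢i Ni⊥i Nj⊥i R⊥i) v) (∂-var-⊕ Ni j≢a v)

  P-i-off : ∀ {a} → a ≢ i → a ≢ j → P (⁅ i ⁆ ∪ ⁅ a ⁆) ≡ ∂ a Ni ⊥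
  P-i-off a≢i a≢j = trans (coefficient-pair P P-anf (≢-sym a≢i)) (∂a∂i-decomp (≢-sym a≢j) ⊥)

  Ni-affine : ∀ {a b} → a ≢ b → a ≢ i → a ≢ j → b ≢ i → ∂ b (∂ a Ni) ⊥ ≡ false
  Ni-affine a≢b a≢i a≢j b≢i =
    trans (≡.sym (∂-cong (∂a∂i-decomp (≢-sym a≢j)) ⊥))
          (∂∂∂-vanish-at-⊥ P P-anf P-deg a≢b (≢-sym a≢i) (≢-sym b≢i))

  Q-i-off : ∀ {a} → a ≢ i → a ≢ j → Q (⁅ i ⁆ ∪ ⁅ a ⁆) ≡ ∂ a Nj ⊥
  Q-i-off a≢i a≢j = trans (coefficient-pair Q Q-anf (≢-sym a≢i))
    (trans (∂-cong (∂-p-iji j≢i Ni⊥i Nj⊥i R⊥i) ⊥) (∂-var-⊕ Nj (≢-sym a≢j) ⊥))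

  Q-i-j : Q (⁅ i ⁆ ∪ ⁅ j ⁆) ≡ true
  Q-i-j = trans (coefficient-pair Q Q-anf (≢-sym j≢i))
    (trans (∂-cong (∂-p-iji j≢i Ni⊥i Nj⊥i R⊥i) ⊥)
      (trans (∂-⊕ (var j) Nj ⊥) (cong₂ _xor_ (∂-var j ⊥) (∂-indep Nj⊥j ⊥))))

module Pivot-coefficients {n} (G : Graph n) {i j : Fin n} (i≢j : i ≢ j) {Ni Nj R : BF n}
  (Ni⊥i : IndepOf Ni i) (Ni⊥j : IndepOf Ni j) (Nj⊥i : IndepOf Nj i) (Nj⊥j : IndepOf Nj j)
  (R⊥i : IndepOf R i) (R⊥j : IndepOf R j)
  (P : ANF n) (P-anf : IsANFOf P (decomp i j Ni Nj R)) (P-deg : DegLe2 P) (P-quad : QuadPartIs P (adj G))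
  (Q : ANF n) (Q-anf : IsANFOf Q (p-iji i j Ni Nj R)) where

  private
    module I = Endpoint-coefficients (≢-sym i≢j) Ni⊥i Nj⊥i R⊥i Nj⊥j P P-anf P-deg Q Q-anf
    module J = Endpoint-coefficients i≢j Nj⊥j Ni⊥j R⊥j Ni⊥i
                 P (λ v → trans (P-anf v) (decomp-swap i j Ni Nj R v)) P-deg
                 Q (λ v → trans (Q-anf v) (p-iji-swap i j Ni Nj R v))

  adj-i≡∂Ni : ∀ {a} → a ≢ i → a ≢ j → adj G i a ≡ ∂ a Ni ⊥
  adj-i≡∂Ni {a} a≢i a≢j = trans (≡.sym (P-quad i a (≢-sym a≢i))) (I.P-i-off a≢i a≢j)

  adj-j≡∂Nj : ∀ {a} → a ≢ i → a ≢ j → adj G j a ≡ ∂ a Nj ⊥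
  adj-j≡∂Nj {a} a≢i a≢j = trans (≡.sym (P-quad j a (≢-sym a≢j))) (J.P-i-off a≢j a≢i)

  Q-i-j : Q (⁅ i ⁆ ∪ ⁅ j ⁆) ≡ true
  Q-i-j = I.Q-i-j

  Q-j-i : Q (⁅ j ⁆ ∪ ⁅ i ⁆) ≡ true
  Q-j-i = J.Q-i-j

  Q-i-off : ∀ {a} → a ≢ i → a ≢ j → Q (⁅ i ⁆ ∪ ⁅ a ⁆) ≡ adj G j a
  Q-i-off a≢i a≢j = trans (I.Q-i-off a≢i a≢j) (≡.sym (adj-j≡∂Nj a≢i a≢j))

  Q-j-off : ∀ {a} → a ≢ i → a ≢ j → Q (⁅ j ⁆ ∪ ⁅ a ⁆) ≡ adj G i a
  Q-j-off a≢i a≢j = trans (J.Q-i-off a≢j a≢i) (≡.sym (adj-i≡∂Ni a≢i a≢j))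

  Q-off-off : ∀ {a b} → a ≢ b → a ≢ i → a ≢ j → b ≢ i → b ≢ j →
    Q (⁅ a ⁆ ∪ ⁅ b ⁆) ≡ adj G a b xor (adj G i a ∧ adj G j b xor adj G j a ∧ adj G i b)
  Q-off-off {a} {b} a≢b a≢i a≢j b≢i b≢j = begin
    Q (⁅ a ⁆ ∪ ⁅ b ⁆)
      ≡⟨ coefficient-pair Q Q-anf a≢b ⟩
    ∂ b (∂ a (p-iji i j Ni Nj R)) ⊥
      ≡⟨ ∂∂-p-iji-at-⊥ Ni Nj R i≢a i≢b j≢a j≢b ⟩
    ∂ b (∂ a (Ni ⊙ Nj)) ⊥ xor ∂ b (∂ a R) ⊥
      ≡⟨ cong₂ _xor_ (∂∂-⊙-at-⊥ Ni Nj a≢b (I.Ni-affine a≢b a≢i a≢j b≢i) (J.Ni-affine a≢b a≢j a≢i b≢j))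
                     (≡.sym (∂∂-decomp-at-⊥ Ni Nj R i≢a i≢b j≢a j≢b)) ⟩
    (∂ a Ni ⊥ ∧ ∂ b Nj ⊥ xor ∂ a Nj ⊥ ∧ ∂ b Ni ⊥) xor ∂ b (∂ a (decomp i j Ni Nj R)) ⊥
      ≡⟨ xor-comm (∂ a Ni ⊥ ∧ ∂ b Nj ⊥ xor ∂ a Nj ⊥ ∧ ∂ b Ni ⊥) (∂ b (∂ a (decomp i j Ni Nj R)) ⊥) ⟩
    ∂ b (∂ a (decomp i j Ni Nj R)) ⊥ xor (∂ a Ni ⊥ ∧ ∂ b Nj ⊥ xor ∂ a Nj ⊥ ∧ ∂ b Ni ⊥)
      ≡⟨ ≡.sym (cong₂ _xor_ (trans (≡.sym (P-quad a b a≢b)) (coefficient-pair P P-anf a≢b))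
                            (cong₂ _xor_ (cong₂ _∧_ (adj-i≡∂Ni a≢i a≢j) (adj-j≡∂Nj b≢i b≢j))
                                         (cong₂ _∧_ (adj-j≡∂Nj a≢i a≢j) (adj-i≡∂Ni b≢i b≢j)))) ⟩
    adj G a b xor (adj G i a ∧ adj G j b xor adj G j a ∧ adj G i b)
      ∎
    where
    i≢a : i ≢ a
    i≢a = ≢-sym a≢i
    i≢b : i ≢ b
    i≢b = ≢-sym b≢i
    j≢a : j ≢ a
    j≢a = ≢-sym a≢j
    j≢b : j ≢ b
    j≢b = ≢-sym b≢j

data Position {n} (i j : Fin n) : Fin n → Set where
  at-i : Position i j i
  at-j : Position i j j
  off  : ∀ {x} → x ≢ i → x ≢ j → Position i j x

position : ∀ {n} (i j x : Fin n) → Position i j x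
position i j x with x ≟ i | x ≟ j
... | yes refl | _        = at-i
... | no _     | yes refl = at-j
... | no x≢i   | no x≢j   = off x≢i x≢j

edge⇒≢ : ∀ {n} (G : Graph n) {x y} → adj G x y ≡ true → x ≢ y
edge⇒≢ G {x} xy∈E refl with trans (≡.sym xy∈E) (irrefl G x)
... | ()

lemma1 : ∀ {n} (G : Graph n) (p : BF n) (P : ANF n)
    → IsANFOf P p → DegLe2 P → QuadPartIs P (adj G)
    → (i j : Fin n) → adj G i j ≡ true
    → (Ni Nj R : BF n)
    → IndepOf Ni i → IndepOf Ni j → IndepOf Nj i → IndepOf Nj j
    → IndepOf R i → IndepOf R j
    → (∀ v → p v ≡ decomp i j Ni Nj R v)
    → (Q : ANF n) → IsANFOf Q (p-iji i j Ni Nj R)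
    → QuadPartIs Q (pivotAdj G i j)
lemma1 G p P P-anf P-deg P-quad i j ij∈E Ni Nj R Ni⊥i Ni⊥j Nj⊥i Nj⊥j R⊥i R⊥j p≗decomp Q Q-anf a b a≢b =
  by-position a≢b (position i j a) (position i j b)
  where
  i≢j : i ≢ j
  i≢j = edge⇒≢ G ij∈E
  open Pivot-coefficients G i≢j Ni⊥i Ni⊥j Nj⊥i Nj⊥j R⊥i R⊥j
         P (λ v → trans (P-anf v) (p≗decomp v)) P-deg P-quad Q Q-anf

  Q-comm : ∀ x y → Q (⁅ x ⁆ ∪ ⁅ y ⁆) ≡ Q (⁅ y ⁆ ∪ ⁅ x ⁆)
  Q-comm x y = cong Q (∪-comm ⁅ x ⁆ ⁅ y ⁆)

  by-position : ∀ {x y} → x ≢ y → Position i j x → Position i j y →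
                Q (⁅ x ⁆ ∪ ⁅ y ⁆) ≡ pivotAdj G i j x y
  by-position x≢y at-i at-i = contradiction refl x≢y
  by-position x≢y at-j at-j = contradiction refl x≢y
  by-position _ at-i at-j = trans Q-i-j (≡.sym (trans (pivot-i-j G i≢j) ij∈E))
  by-position _ at-j at-i = trans Q-j-i (≡.sym (trans (pivot-j-i G i≢j) ij∈E))
  by-position _ at-i (off y≢i y≢j) = trans (Q-i-off y≢i y≢j) (≡.sym (pivot-i-off G i≢j y≢i y≢j))
  by-position _ at-j (off y≢i y≢j) = trans (Q-j-off y≢i y≢j) (≡.sym (pivot-j-off G i≢j y≢i y≢j))
  by-position {x} _ (off x≢i x≢j) at-i =
    trans (Q-comm x i) (trans (Q-i-off x≢i x≢j) (≡.sym (pivot-off-i G i≢j x≢i x≢j)))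
  by-position {x} _ (off x≢i x≢j) at-j =
    trans (Q-comm x j) (trans (Q-j-off x≢i x≢j) (≡.sym (pivot-off-j G i≢j x≢i x≢j)))
  by-position x≢y (off x≢i x≢j) (off y≢i y≢j) =
    trans (Q-off-off x≢y x≢i x≢j y≢i y≢j) (≡.sym (pivot-off-off G i≢j x≢i x≢j y≢i y≢j))
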